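{- Consider an instance of fixed order scheduling with deadlines in which the slacks are non-increasing along the fixed order, i.e. $d_1-p_1\ge d_2-p_2\ge\cdots\ge d_n-p_n$. Then the schedule produced by the next-fit algorithm is identical to the schedule produced by the first-fit algorithm.
   Context: Fixed order scheduling with deadlines: there are $n$ jobs $1,\dots,n$, job $j$ having processing time $p_j\in\mathbb{N}$, $p_j>0$, and deadline $d_j\in\mathbb{N}$ with $d_j\ge p_j$; the slack of job $j$ is $d_j-p_j$. All jobs are released at time $0$, and there are sufficiently many identical machines. Each machine processes its assigned jobs non-preemptively, without idle time, in increasing order of job index; a job $j$ meets its deadline if the total processing time of jobs $k\le j$ on its machine is at most $d_j$. The first-fit algorithm (FF) considers jobs in order $1,\dots,n$ and appends each job to the lowest-indexed open machine on which it would meet its deadline, opening a new machine if there is none. The next-fit algorithm (NF) considers jobs in order $1,\dots,n$ and appends each job to the most recently opened machine if it would meet its deadline there, and otherwise opens a new machine. -}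

module Defs where

open import Data.Nat using (ℕ; zero; suc; _+_; _∸_; _≤_; _≥_; _<_; _≤?_)
open import Data.List using (List; []; _∷_; length; _++_; [_])
open import Data.List.Relation.Unary.All using (All)
open import Data.Product using (_×_; _,_; proj₁; proj₂)
open import Relation.Nullary.Decidable using (yes; no)

Job : Set
Job = ℕ × ℕ

proc : Job → ℕ
proc = proj₁

deadline : Job → ℕ
deadline = proj₂

slack : Job → ℕ
slack j = deadline j ∸ proc j

ValidJob : Job → Set
ValidJob j = (0 < proc j) × (proc j ≤ deadline j)

data SlackNonIncreasing : List Job → Set where
  []  : SlackNonIncreasing []
  [-] : ∀ j → SlackNonIncreasing (j ∷ [])
  _∷_ : ∀ {j k js} → slack j ≥ slack k →
        SlackNonIncreasing (k ∷ js) → SlackNonIncreasing (j ∷ k ∷ js)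

-- A machine state is its current load (total processing time of the jobs
-- assigned to it so far); the open machines are listed in order of opening
-- (index 0 = first opened).  A schedule is recorded as the list giving,
-- for each job in order 1..n, the index (0-based, in order of opening) of
-- the machine it is assigned to.  Since machines process their jobs in
-- increasing index order, this assignment determines the schedule entirely.

ffPlace : Job → List ℕ → ℕ × List ℕ
ffPlace j [] = 0 , (proc j ∷ [])
ffPlace j (l ∷ ls) with l + proc j ≤? deadline j
... | yes _ = 0 , (l + proc j ∷ ls)
... | no  _ with ffPlace j ls
...   | (i , ls') = suc i , (l ∷ ls')

ffRun : List ℕ → List Job → List ℕ
ffRun loads [] = []
ffRun loads (j ∷ js) with ffPlace j loads
... | (i , loads') = i ∷ ffRun loads' js

firstFit : List Job → List ℕ
firstFit = ffRun []

nfRun : ℕ → ℕ → List Job → List ℕ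
-- nfRun m load js : m machines open (m = 0 means none), load of machine m-1.
nfRun m load [] = []
nfRun zero load (j ∷ js) = 0 ∷ nfRun 1 (proc j) js
nfRun (suc k) load (j ∷ js) with load + proc j ≤? deadline j
... | yes _ = k ∷ nfRun (suc k) (load + proc j) js
... | no  _ = suc k ∷ nfRun (suc (suc k)) (proc j) js

nextFit : List Job → List ℕ
nextFit = nfRun 0 0

{-# OPTIONS --safe #-}
-- A job fits on a machine iff the machine's load is at most the job's slack.
-- A machine stops being the last opened one only when some job j does not fit
-- on it, i.e. its load exceeds slack j; as slacks never increase, no later job
-- fits on it either.  So first-fit only ever uses the last opened machine,
-- exactly like next-fit.
module Submission where

open import Defs
open import Data.List using (List; []; _∷_; _++_; _∷ʳ_; [_]; length)
open import Data.List.Properties using (length-++; ++-assoc)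
open import Data.List.Relation.Unary.All using (All; []; _∷_)
import Data.List.Relation.Unary.All as All
open import Data.List.Relation.Unary.All.Properties using (++⁺)
open import Data.Nat using (ℕ; suc; _+_; _≤_; _<_; _≤?_)
open import Data.Nat.Properties
  using (<⇒≱; ≰⇒>; ≤-<-trans; +-identityʳ; +-comm; m+n≤o⇒m≤o∸n; m≤o∸n⇒m+n≤o)
open import Data.Product as Product using (_×_; _,_; proj₂)
open import Data.Unit using (⊤)
open import Relation.Nullary using (¬_; yes; no; contradiction)
open import Relation.Binary.PropositionalEquality
  using (_≡_; refl; cong; cong₂; trans; sym; module ≡-Reasoning)

Fits : Job → ℕ → Set
Fits j l = l + proc j ≤ deadline j

slack<⇒¬Fits : ∀ {j l} → slack j < l → ¬ Fits j l
slack<⇒¬Fits {l = l} slack<l fits = <⇒≱ slack<l (m+n≤o⇒m≤o∸n l fits)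

¬Fits⇒slack< : ∀ {j l} → proc j ≤ deadline j → ¬ Fits j l → slack j < l
¬Fits⇒slack< {l = l} p≤d ¬fits = ≰⇒> (λ l≤slack → ¬fits (m≤o∸n⇒m+n≤o l p≤d l≤slack))

ffPlace-++-¬Fits : ∀ {j} ls ms → All (λ l → ¬ Fits j l) ls →
  ffPlace j (ls ++ ms) ≡ Product.map (length ls +_) (ls ++_) (ffPlace j ms)
ffPlace-++-¬Fits     []       ms []               = refl
ffPlace-++-¬Fits {j} (l ∷ ls) ms (¬fits ∷ ¬fitss) with l + proc j ≤? deadline j
... | yes fits = contradiction fits ¬fits
... | no _ = cong (Product.map suc (l ∷_)) (ffPlace-++-¬Fits ls ms ¬fitss)

FullFor : List Job → ℕ → Set
FullFor []      _ = ⊤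
FullFor (j ∷ _) l = slack j < l

FullFor-tail : ∀ {j js l} → SlackNonIncreasing (j ∷ js) → slack j < l → FullFor js l
FullFor-tail ([-] _)      _       = _
FullFor-tail (slack≥ ∷ _) slack<l = ≤-<-trans slack≥ slack<l

SlackNonIncreasing-tail : ∀ {j js} → SlackNonIncreasing (j ∷ js) → SlackNonIncreasing js
SlackNonIncreasing-tail ([-] _)      = []
SlackNonIncreasing-tail (_ ∷ sorted) = sorted

length-∷ʳ : ∀ (xs : List ℕ) x → length (xs ∷ʳ x) ≡ suc (length xs)
length-∷ʳ xs x = trans (length-++ xs) (+-comm (length xs) 1)

nfRun≡ffRun : ∀ ls L js → All (λ j → proc j ≤ deadline j) js → SlackNonIncreasing js →
  All (FullFor js) ls → nfRun (suc (length ls)) L js ≡ ffRun (ls ∷ʳ L) js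
nfRun≡ffRun ls L [] _ _ _ = refl
nfRun≡ffRun ls L (j ∷ js) (p≤d ∷ p≤ds) sorted full = begin
  nfRun (suc (length ls)) L (j ∷ js)
    ≡⟨ nfRun-step ⟩
  ffStep (Product.map (length ls +_) (ls ++_) (ffPlace j [ L ]))
    ≡⟨ cong ffStep (ffPlace-++-¬Fits ls [ L ] (All.map slack<⇒¬Fits full)) ⟨
  ffRun (ls ∷ʳ L) (j ∷ js) ∎
  where
  open ≡-Reasoning

  ffStep : ℕ × List ℕ → List ℕ
  ffStep (i , loads) = i ∷ ffRun loads js

  sorted′ : SlackNonIncreasing js
  sorted′ = SlackNonIncreasing-tail sorted

  nfRun-step : nfRun (suc (length ls)) L (j ∷ js)
             ≡ ffStep (Product.map (length ls +_) (ls ++_) (ffPlace j [ L ]))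
  nfRun-step with L + proc j ≤? deadline j
  ... | yes _ = cong₂ _∷_ (sym (+-identityʳ (length ls)))
    (nfRun≡ffRun ls (L + proc j) js p≤ds sorted′ (All.map (FullFor-tail sorted) full))
  ... | no ¬fits = cong₂ _∷_ (+-comm 1 (length ls)) (begin
      nfRun (suc (suc (length ls))) (proc j) js
        ≡⟨ cong (λ k → nfRun (suc k) (proc j) js) (length-∷ʳ ls L) ⟨
      nfRun (suc (length (ls ∷ʳ L))) (proc j) js
        ≡⟨ nfRun≡ffRun (ls ∷ʳ L) (proc j) js p≤ds sorted′
             (All.map (FullFor-tail sorted) (++⁺ full (¬Fits⇒slack< p≤d ¬fits ∷ []))) ⟩
      ffRun (ls ∷ʳ L ∷ʳ proc j) js
        ≡⟨ cong (λ loads → ffRun loads js) (++-assoc ls [ L ] [ proc j ]) ⟩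
      ffRun (ls ++ L ∷ proc j ∷ []) js ∎)

lemma2 : (jobs : List Job) → All ValidJob jobs → SlackNonIncreasing jobs →
    nextFit jobs ≡ firstFit jobs
lemma2 []         _           _      = refl
lemma2 (j ∷ jobs) (_ ∷ valid) sorted =
  cong (0 ∷_) (nfRun≡ffRun [] (proc j) jobs (All.map proj₂ valid)
    (SlackNonIncreasing-tail sorted) [])
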